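{- If a (non-empty) sequent $\vdash\Gamma$ is provable in $\mathsf{MLL1^X}$, then the formula $\bigvee\Gamma$ is provable in $\mathsf{MLS1^X}$.
   Context: Formulas: terms $t::=x\mid f(t_1,\dots,t_n)$; atoms $a::=\mathsf t\mid\mathsf f\mid p(\vec t)\mid\bar p(\vec t)$ (each predicate $p$ has a dual $\bar p$, $\bar{\bar p}=p$); formulas $A::=a\mid A\wedge A\mid A\vee A\mid\exists x.A\mid\forall x.A$ with $\overline{p(\vec t)}=\bar p(\vec t)$, $\bar{\mathsf t}=\mathsf f$. A sequent is a finite multiset of formulas; $\bigvee\Gamma=A_1\vee\dots\vee A_n$ for $\Gamma=A_1,\dots,A_n$. $\mathsf{MLL1^X}$ has rules: $\mathsf{ax}$: $\vdash a,\bar a$; $\vee$: from $\vdash\Gamma,A,B$ infer $\vdash\Gamma,A\vee B$; $\wedge$: from $\vdash\Gamma,A$ and $\vdash B,\Delta$ infer $\vdash\Gamma,A\wedge B,\Delta$; $\mathsf t$: $\vdash\mathsf t$; $\mathsf f$: from $\vdash\Gamma$ infer $\vdash\Gamma,\mathsf f$; $\mathsf{mix}$: from $\vdash\Gamma$, $\vdash\Delta$ infer $\vdash\Gamma,\Delta$; $\exists$: from $\vdash\Gamma,A[x/t]$ infer $\vdash\Gamma,\exists x.A$; $\forall$: from $\vdash\Gamma,A$ infer $\vdash\Gamma,\forall x.A$ if $x$ not free in $\Gamma$. $\equiv$ is the smallest congruence with $\wedge,\vee$ commutative and associative, $\forall x\forall y.A\equiv\forall y\forall x.A$, $\exists x\exists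 y.A\equiv\exists y\exists x.A$, $\forall x.(A\vee B)\equiv(\forall x.A)\vee B$, $\exists x.(A\wedge B)\equiv(\exists x.A)\wedge B$ ($x$ not free in $B$). A context $S\{\ \}$ is a formula with one hole in place of an atom. $\mathsf{MLS1^X}$ rules (premise $\Rightarrow$ conclusion in any context): $\forall$: $S\{\mathsf t\}\Rightarrow S\{\forall x.\mathsf t\}$; $\mathsf{ai}$: $S\{\mathsf t\}\Rightarrow S\{a\vee\bar a\}$; $\mathsf t$-rule: $S\{A\}\Rightarrow S\{A\wedge\mathsf t\}$; $\mathsf s$: $S\{A\wedge(B\vee C)\}\Rightarrow S\{(A\wedge B)\vee C\}$; $\mathsf{mix}$: $S\{A\wedge B\}\Rightarrow S\{A\vee B\}$; $\exists$: $S\{A[x/t]\}\Rightarrow S\{\exists x.A\}$; $\equiv$: $S\{B\}\Rightarrow S\{A\}$ if $A\equiv B$. A formula is provable in $\mathsf{MLS1^X}$ if there is a finite sequence of formulas from $\mathsf t$ to it, each step a rule instance. -}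

module Defs where

open import Data.Nat using (ℕ; zero; suc)
open import Data.Bool using (Bool; not)
open import Data.List using (List; []; _∷_; _++_; map)
open import Data.List.Relation.Binary.Permutation.Propositional using (_↭_)
open import Relation.Binary.Construct.Closure.ReflexiveTransitive using (Star)

-- Terms (de Bruijn variables; function symbols named by ℕ)

data Term : Set where
  var : ℕ → Term
  fn  : ℕ → List Term → Term

Ren : Set
Ren = ℕ → ℕ

liftR : Ren → Ren
liftR ρ zero    = zero
liftR ρ (suc n) = suc (ρ n)

mutual
  renT : Ren → Term → Term
  renT ρ (var n)   = var (ρ n)
  renT ρ (fn f ts) = fn f (renTs ρ ts)

  renTs : Ren → List Term → List Term
  renTs ρ []       = []
  renTs ρ (t ∷ ts) = renT ρ t ∷ renTs ρ ts

Sub : Set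
Sub = ℕ → Term

liftS : Sub → Sub
liftS σ zero    = var zero
liftS σ (suc n) = renT suc (σ n)

mutual
  subT : Sub → Term → Term
  subT σ (var n)   = σ n
  subT σ (fn f ts) = fn f (subTs σ ts)

  subTs : Sub → List Term → List Term
  subTs σ []       = []
  subTs σ (t ∷ ts) = subT σ t ∷ subTs σ ts

-- Atoms: t, f, and p(ts) where a predicate is a name with a polarity;
-- the dual predicate flips the polarity (so the dual of the dual is p).

data Atom : Set where
  tt : Atom
  ff : Atom
  pr : ℕ → Bool → List Term → Atom

dualA : Atom → Atom
dualA tt          = ff
dualA ff          = tt
dualA (pr p b ts) = pr p (not b) ts

-- Formulas (∃ and ∀ bind de Bruijn variable 0)

infixr 6 _∧_
infixr 5 _∨_

data Formula : Set where
  atom : Atom → Formula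
  _∧_  : Formula → Formula → Formula
  _∨_  : Formula → Formula → Formula
  ex   : Formula → Formula
  all  : Formula → Formula

renA : Ren → Atom → Atom
renA ρ tt          = tt
renA ρ ff          = ff
renA ρ (pr p b ts) = pr p b (renTs ρ ts)

ren : Ren → Formula → Formula
ren ρ (atom a) = atom (renA ρ a)
ren ρ (A ∧ B)  = ren ρ A ∧ ren ρ B
ren ρ (A ∨ B)  = ren ρ A ∨ ren ρ B
ren ρ (ex A)   = ex (ren (liftR ρ) A)
ren ρ (all A)  = all (ren (liftR ρ) A)

subA : Sub → Atom → Atom
subA σ tt          = tt
subA σ ff          = ff
subA σ (pr p b ts) = pr p b (subTs σ ts)

sub : Sub → Formula → Formula
sub σ (atom a) = atom (subA σ a)
sub σ (A ∧ B)  = sub σ A ∧ sub σ B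
sub σ (A ∨ B)  = sub σ A ∨ sub σ B
sub σ (ex A)   = ex (sub (liftS σ) A)
sub σ (all A)  = all (sub (liftS σ) A)

-- weakening: B viewed under one extra binder (the bound variable is not free in it)
wk : Formula → Formula
wk = ren suc

-- A[x/t] where x is the variable bound by the enclosing quantifier
sub0 : Term → Sub
sub0 t zero    = t
sub0 t (suc n) = var n

_[_] : Formula → Term → Formula
A [ t ] = sub (sub0 t) A

-- swapping the two innermost bound variables (for ∀x∀y ≡ ∀y∀x)
swapR : Ren
swapR zero          = suc zero
swapR (suc zero)    = zero
swapR (suc (suc n)) = suc (suc n)

swap : Formula → Formula
swap = ren swapR

tF fF : Formula
tF = atom tt
fF = atom ff

-- MLL1^X: sequents are lists up to permutation (multisets)

data ⊢_ : List Formula → Set where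
  exch   : ∀ {Γ Δ} → Γ ↭ Δ → ⊢ Γ → ⊢ Δ
  ax     : ∀ a → ⊢ (atom a ∷ atom (dualA a) ∷ [])
  ∨-rule : ∀ {Γ A B} → ⊢ (A ∷ B ∷ Γ) → ⊢ ((A ∨ B) ∷ Γ)
  ∧-rule : ∀ {Γ Δ A B} → ⊢ (A ∷ Γ) → ⊢ (B ∷ Δ) → ⊢ ((A ∧ B) ∷ Γ ++ Δ)
  t-rule : ⊢ (tF ∷ [])
  f-rule : ∀ {Γ} → ⊢ Γ → ⊢ (fF ∷ Γ)
  mix    : ∀ {Γ Δ} → ⊢ Γ → ⊢ Δ → ⊢ (Γ ++ Δ)
  ∃-rule : ∀ {Γ A} t → ⊢ ((A [ t ]) ∷ Γ) → ⊢ (ex A ∷ Γ)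
  -- eigenvariable condition: Γ is weakened, so the bound variable is not free in Γ
  ∀-rule : ∀ {Γ A} → ⊢ (A ∷ map wk Γ) → ⊢ (all A ∷ Γ)

-- ⋁Γ for a non-empty sequent A , Γ
⋁ : Formula → List Formula → Formula
⋁ A []      = A
⋁ A (B ∷ Γ) = A ∨ ⋁ B Γ

infix 4 _≅_

data _≅_ : Formula → Formula → Set where
  refl≅  : ∀ {A} → A ≅ A
  sym≅   : ∀ {A B} → A ≅ B → B ≅ A
  trans≅ : ∀ {A B C} → A ≅ B → B ≅ C → A ≅ C
  cong∧  : ∀ {A A' B B'} → A ≅ A' → B ≅ B' → (A ∧ B) ≅ (A' ∧ B')
  cong∨  : ∀ {A A' B B'} → A ≅ A' → B ≅ B' → (A ∨ B) ≅ (A' ∨ B')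
  cong∃  : ∀ {A A'} → A ≅ A' → ex A ≅ ex A'
  cong∀  : ∀ {A A'} → A ≅ A' → all A ≅ all A'
  ∧-comm  : ∀ {A B} → (A ∧ B) ≅ (B ∧ A)
  ∧-assoc : ∀ {A B C} → ((A ∧ B) ∧ C) ≅ (A ∧ (B ∧ C))
  ∨-comm  : ∀ {A B} → (A ∨ B) ≅ (B ∨ A)
  ∨-assoc : ∀ {A B C} → ((A ∨ B) ∨ C) ≅ (A ∨ (B ∨ C))
  ∀∀     : ∀ {A} → all (all A) ≅ all (all (swap A))
  ∃∃     : ∀ {A} → ex (ex A) ≅ ex (ex (swap A))
  ∀∨     : ∀ {A B} → all (A ∨ wk B) ≅ (all A ∨ B)
  ∃∧     : ∀ {A B} → ex (A ∧ wk B) ≅ (ex A ∧ B)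

data Ctx : Set where
  ∙    : Ctx
  _∧ₗ_ : Ctx → Formula → Ctx
  _∧ᵣ_ : Formula → Ctx → Ctx
  _∨ₗ_ : Ctx → Formula → Ctx
  _∨ᵣ_ : Formula → Ctx → Ctx
  exC  : Ctx → Ctx
  allC : Ctx → Ctx

_⟪_⟫ : Ctx → Formula → Formula
∙        ⟪ A ⟫ = A
(S ∧ₗ B) ⟪ A ⟫ = S ⟪ A ⟫ ∧ B
(B ∧ᵣ S) ⟪ A ⟫ = B ∧ S ⟪ A ⟫
(S ∨ₗ B) ⟪ A ⟫ = S ⟪ A ⟫ ∨ B
(B ∨ᵣ S) ⟪ A ⟫ = B ∨ S ⟪ A ⟫
exC S    ⟪ A ⟫ = ex (S ⟪ A ⟫)
allC S   ⟪ A ⟫ = all (S ⟪ A ⟫)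

-- MLS1^X: one inference step, premise ⇒ conclusion

data _⇒_ : Formula → Formula → Set where
  ∀-step   : ∀ S → (S ⟪ tF ⟫) ⇒ (S ⟪ all tF ⟫)
  ai-step  : ∀ S a → (S ⟪ tF ⟫) ⇒ (S ⟪ atom a ∨ atom (dualA a) ⟫)
  t-step   : ∀ S A → (S ⟪ A ⟫) ⇒ (S ⟪ A ∧ tF ⟫)
  s-step   : ∀ S A B C → (S ⟪ A ∧ (B ∨ C) ⟫) ⇒ (S ⟪ (A ∧ B) ∨ C ⟫)
  mix-step : ∀ S A B → (S ⟪ A ∧ B ⟫) ⇒ (S ⟪ A ∨ B ⟫)
  ∃-step   : ∀ S A t → (S ⟪ A [ t ] ⟫) ⇒ (S ⟪ ex A ⟫)
  ≡-step   : ∀ S {A B} → A ≅ B → (S ⟪ B ⟫) ⇒ (S ⟪ A ⟫)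

MLS-provable : Formula → Set
MLS-provable A = Star _⇒_ tF A

-- Induction on the MLL1^X derivation, reading each sequent rule as a derived
-- rule of MLS1^X acting on the disjunction of the sequent. The premises of ∧
-- and mix are proved side by side under A ⇒ A ∧ t; for ∧ two switches then
-- move the principal conjunction onto the two principal formulas, for mix a
-- single mix step suffices. Axioms and the f rule come from the atomic
-- interaction ai (on t ∨ f for the latter), and the ∀ rule from ∀x.t together
-- with ∀x.(A ∨ B) ≡ (∀x.A) ∨ B, which is where the eigenvariable condition enters.
module Submission where

open import Defs
open import Data.List using (List; []; _∷_; _++_; map)
open import Data.List.Properties using (++-conicalˡ)
open import Data.List.Relation.Binary.Permutation.Propositional
  using (_↭_; refl; prep; swap; trans; ↭-sym)
open import Data.List.Relation.Binary.Permutation.Propositional.Properties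
  using (↭-empty-inv; ¬x∷xs↭[]; ++-comm)
open import Data.Empty using (⊥-elim)
open import Relation.Binary.PropositionalEquality
  using (_≡_; _≢_; refl; sym; cong; subst; subst₂)
open import Relation.Binary.Construct.Closure.ReflexiveTransitive
  using (Star; ε; _◅_; _◅◅_)

infix 4 _⇒*_

_⇒*_ : Formula → Formula → Set
_⇒*_ = Star _⇒_

infixr 9 _∘ᶜ_

_∘ᶜ_ : Ctx → Ctx → Ctx
∙        ∘ᶜ S' = S'
(S ∧ₗ B) ∘ᶜ S' = (S ∘ᶜ S') ∧ₗ B
(B ∧ᵣ S) ∘ᶜ S' = B ∧ᵣ (S ∘ᶜ S')
(S ∨ₗ B) ∘ᶜ S' = (S ∘ᶜ S') ∨ₗ B
(B ∨ᵣ S) ∘ᶜ S' = B ∨ᵣ (S ∘ᶜ S')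
exC S    ∘ᶜ S' = exC (S ∘ᶜ S')
allC S   ∘ᶜ S' = allC (S ∘ᶜ S')

plug-∘ᶜ : ∀ S S' X → S ⟪ S' ⟪ X ⟫ ⟫ ≡ (S ∘ᶜ S') ⟪ X ⟫
plug-∘ᶜ ∙        S' X = refl
plug-∘ᶜ (S ∧ₗ B) S' X = cong (_∧ B) (plug-∘ᶜ S S' X)
plug-∘ᶜ (B ∧ᵣ S) S' X = cong (B ∧_) (plug-∘ᶜ S S' X)
plug-∘ᶜ (S ∨ₗ B) S' X = cong (_∨ B) (plug-∘ᶜ S S' X)
plug-∘ᶜ (B ∨ᵣ S) S' X = cong (B ∨_) (plug-∘ᶜ S S' X)
plug-∘ᶜ (exC S)  S' X = cong ex (plug-∘ᶜ S S' X)
plug-∘ᶜ (allC S) S' X = cong all (plug-∘ᶜ S S' X)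

plug-∘ᶜ⇒ : ∀ S S' {U V} → ((S ∘ᶜ S') ⟪ U ⟫) ⇒ ((S ∘ᶜ S') ⟪ V ⟫) → (S ⟪ S' ⟪ U ⟫ ⟫) ⇒ (S ⟪ S' ⟪ V ⟫ ⟫)
plug-∘ᶜ⇒ S S' = subst₂ _⇒_ (sym (plug-∘ᶜ S S' _)) (sym (plug-∘ᶜ S S' _))

⇒-plug : ∀ S {X Y} → X ⇒ Y → (S ⟪ X ⟫) ⇒ (S ⟪ Y ⟫)
⇒-plug S (∀-step S')       = plug-∘ᶜ⇒ S S' (∀-step (S ∘ᶜ S'))
⇒-plug S (ai-step S' a)    = plug-∘ᶜ⇒ S S' (ai-step (S ∘ᶜ S') a)
⇒-plug S (t-step S' A)     = plug-∘ᶜ⇒ S S' (t-step (S ∘ᶜ S') A)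
⇒-plug S (s-step S' A B C) = plug-∘ᶜ⇒ S S' (s-step (S ∘ᶜ S') A B C)
⇒-plug S (mix-step S' A B) = plug-∘ᶜ⇒ S S' (mix-step (S ∘ᶜ S') A B)
⇒-plug S (∃-step S' A t)   = plug-∘ᶜ⇒ S S' (∃-step (S ∘ᶜ S') A t)
⇒-plug S (≡-step S' A≅B)   = plug-∘ᶜ⇒ S S' (≡-step (S ∘ᶜ S') A≅B)

⇒*-plug : ∀ S {X Y} → X ⇒* Y → S ⟪ X ⟫ ⇒* S ⟪ Y ⟫
⇒*-plug S ε        = ε
⇒*-plug S (r ◅ rs) = ⇒-plug S r ◅ ⇒*-plug S rs

≅⇒* : ∀ {A B} → A ≅ B → A ⇒* B
≅⇒* A≅B = ≡-step ∙ (sym≅ A≅B) ◅ ε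

step : ∀ {A B} → A ⇒ B → A ⇒* B
step r = r ◅ ε

∧-intro : ∀ {X Y} → tF ⇒* X → tF ⇒* Y → tF ⇒* X ∧ Y
∧-intro {X} ⊢X ⊢Y = step (t-step ∙ tF) ◅◅ ⇒*-plug (∙ ∧ₗ tF) ⊢X ◅◅ ⇒*-plug (X ∧ᵣ ∙) ⊢Y

-- The value at [] is never used: derivable sequents are non-empty.
⋁* : List Formula → Formula
⋁* []      = tF
⋁* (A ∷ Γ) = ⋁ A Γ

headᶜ : List Formula → Ctx
headᶜ []      = ∙
headᶜ (B ∷ Γ) = ∙ ∨ₗ ⋁ B Γ

plug-headᶜ : ∀ Γ X → headᶜ Γ ⟪ X ⟫ ≡ ⋁ X Γ
plug-headᶜ []      X = refl
plug-headᶜ (B ∷ Γ) X = refl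

⋁-head : ∀ Γ {X Y} → X ⇒* Y → ⋁ X Γ ⇒* ⋁ Y Γ
⋁-head Γ {X} {Y} X⇒*Y = subst₂ _⇒*_ (plug-headᶜ Γ X) (plug-headᶜ Γ Y) (⇒*-plug (headᶜ Γ) X⇒*Y)

⋁-∨ : ∀ A B Γ → ⋁ (A ∨ B) Γ ≅ A ∨ ⋁ B Γ
⋁-∨ A B []      = refl≅
⋁-∨ A B (C ∷ Γ) = ∨-assoc

⋁-⋁ : ∀ A Δ Γ → ⋁ (⋁ A Δ) Γ ≅ ⋁ A (Δ ++ Γ)
⋁-⋁ A []      Γ = refl≅
⋁-⋁ A (B ∷ Δ) Γ = trans≅ (⋁-∨ A (⋁ B Δ) Γ) (cong∨ refl≅ (⋁-⋁ B Δ Γ))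

⋁*-∷-cong : ∀ A {Γ Δ} → Γ ↭ Δ → ⋁* Γ ≅ ⋁* Δ → ⋁* (A ∷ Γ) ≅ ⋁* (A ∷ Δ)
⋁*-∷-cong A {[]}    {[]}    _ _   = refl≅
⋁*-∷-cong A {_ ∷ _} {_ ∷ _} _ Γ≅Δ = cong∨ refl≅ Γ≅Δ
⋁*-∷-cong A {[]}    {_ ∷ _} p _   = ⊥-elim (¬x∷xs↭[] (↭-sym p))
⋁*-∷-cong A {_ ∷ _} {[]}    p _   = ⊥-elim (¬x∷xs↭[] p)

⋁*-swap : ∀ A B Γ → ⋁* (A ∷ B ∷ Γ) ≅ ⋁* (B ∷ A ∷ Γ)
⋁*-swap A B []      = ∨-comm
⋁*-swap A B (C ∷ Γ) = trans≅ (sym≅ ∨-assoc) (trans≅ (cong∨ ∨-comm refl≅) ∨-assoc)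

⋁*-↭ : ∀ {Γ Δ} → Γ ↭ Δ → ⋁* Γ ≅ ⋁* Δ
⋁*-↭ refl         = refl≅
⋁*-↭ (prep A p)   = ⋁*-∷-cong A p (⋁*-↭ p)
⋁*-↭ (swap A B p) =
  trans≅ (⋁*-swap A B _) (⋁*-∷-cong B (prep A p) (⋁*-∷-cong A p (⋁*-↭ p)))
⋁*-↭ (trans p q)  = trans≅ (⋁*-↭ p) (⋁*-↭ q)

⋁-map-wk : ∀ A Γ → ⋁ (wk A) (map wk Γ) ≡ wk (⋁ A Γ)
⋁-map-wk A []      = refl
⋁-map-wk A (B ∷ Γ) = cong (wk A ∨_) (⋁-map-wk B Γ)

all-⋁-map-wk : ∀ A Γ → all (⋁ A (map wk Γ)) ≅ ⋁ (all A) Γ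
all-⋁-map-wk A []      = refl≅
all-⋁-map-wk A (B ∷ Γ) =
  subst (λ Z → all (A ∨ Z) ≅ all A ∨ ⋁ B Γ) (sym (⋁-map-wk B Γ)) ∀∨

switch-⋁ʳ : ∀ A B Δ → A ∧ ⋁ B Δ ⇒* ⋁ (A ∧ B) Δ
switch-⋁ʳ A B []      = ε
switch-⋁ʳ A B (C ∷ Δ) = step (s-step ∙ A B (⋁ C Δ))

switch-⋁ˡ : ∀ A Γ B → ⋁ A Γ ∧ B ⇒* ⋁ (A ∧ B) Γ
switch-⋁ˡ A Γ B = ≅⇒* ∧-comm ◅◅ switch-⋁ʳ B A Γ ◅◅ ⋁-head Γ (≅⇒* ∧-comm)

⋁-∧-⋁ : ∀ A Γ B Δ → ⋁ A Γ ∧ ⋁ B Δ ⇒* ⋁ (A ∧ B) (Γ ++ Δ)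
⋁-∧-⋁ A Γ B Δ =
  switch-⋁ˡ A Γ (⋁ B Δ) ◅◅ ⋁-head Γ (switch-⋁ʳ A B Δ) ◅◅
  ≅⇒* (trans≅ (⋁-⋁ (A ∧ B) Δ Γ) (⋁*-↭ (prep (A ∧ B) (++-comm Δ Γ))))

⊢-nonempty : ∀ {Γ} → ⊢ Γ → Γ ≢ []
⊢-nonempty (exch p d)        refl     = ⊢-nonempty d (↭-empty-inv p)
⊢-nonempty (mix {Γ} {Δ} d _) Γ++Δ≡[] = ⊢-nonempty d (++-conicalˡ Γ Δ Γ++Δ≡[])
⊢-nonempty {_ ∷ _} _           ()

⊢⇒⋁* : ∀ {Γ} → ⊢ Γ → tF ⇒* ⋁* Γ
⊢⇒⋁* (exch p d)                 = ⊢⇒⋁* d ◅◅ ≅⇒* (⋁*-↭ p)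
⊢⇒⋁* (ax a)                     = step (ai-step ∙ a)
⊢⇒⋁* (∨-rule {Γ} {A} {B} d)     = ⊢⇒⋁* d ◅◅ ≅⇒* (sym≅ (⋁-∨ A B Γ))
⊢⇒⋁* (∧-rule {Γ} {Δ} {A} {B} d e) =
  ∧-intro (⊢⇒⋁* d) (⊢⇒⋁* e) ◅◅ ⋁-∧-⋁ A Γ B Δ
⊢⇒⋁* t-rule                     = ε
⊢⇒⋁* (f-rule {[]} d)            = ⊥-elim (⊢-nonempty d refl)
⊢⇒⋁* (f-rule {_ ∷ _} d)         =
  step (ai-step ∙ tt) ◅◅ ⇒*-plug (∙ ∨ₗ fF) (⊢⇒⋁* d) ◅◅ ≅⇒* ∨-comm
⊢⇒⋁* (mix {[]} d _)             = ⊥-elim (⊢-nonempty d refl)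
⊢⇒⋁* (mix {_ ∷ _} {[]} _ e)     = ⊥-elim (⊢-nonempty e refl)
⊢⇒⋁* (mix {A ∷ Γ} {B ∷ Δ} d e)  =
  ∧-intro (⊢⇒⋁* d) (⊢⇒⋁* e) ◅◅ step (mix-step ∙ _ _) ◅◅ ≅⇒* (⋁-⋁ A Γ (B ∷ Δ))
⊢⇒⋁* (∃-rule {Γ} {A} t d)       = ⊢⇒⋁* d ◅◅ ⋁-head Γ (step (∃-step ∙ A t))
⊢⇒⋁* (∀-rule {Γ} {A} d)         =
  step (∀-step ∙) ◅◅ ⇒*-plug (allC ∙) (⊢⇒⋁* d) ◅◅ ≅⇒* (all-⋁-map-wk A Γ)

lemma7p1 : (A : Formula) (Γ : List Formula) → ⊢ (A ∷ Γ) → MLS-provable (⋁ A Γ)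
lemma7p1 A Γ = ⊢⇒⋁*
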